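{- Let $m,n$ be natural numbers and $f:m^2\to n\cup\{\infty\}$ any function. Then $\Gamma_f(\infty)\subset\Gamma_f^\perp$ and $\Gamma_f(\infty)$ is dense in $\Gamma_f^\perp$, i.e. every infinite $x\in\Gamma_f^\perp$ contains an infinite $x'\in\Gamma_f(\infty)$. Consequently, $\Gamma_f$ is dense (i.e. $\Gamma_f^\perp$ consists only of finite sets) if and only if $\infty$ is not in the range of $f$.
   Context: $n=\{0,\dots,n-1\}$, $\infty$ an extra symbol. $m^{<\omega}$ is the set of finite sequences from $m$, ordered by initial segment, concatenation $s^\frown i$, length $|s|$. A $u$-chain is an infinite set $\{s[0],s[1],\dots\}$ with $s[i]^\frown u\leq s[i+1]$; for $u\neq v$ a $(u,v)$-comb is an infinite set $\{t[i]\}$ with a $u$-chain $\{s[i]\}$ such that $s[i]^\frown v\leq t[i]$ and $|t[i]|<|s[i+1]|$; a $(u,u)$-comb is a $u$-chain. For $\xi\in n\cup\{\infty\}$, $\Gamma_f(\xi)$ is the ideal on $m^{<\omega}$ generated by finite sets and all $(u,v)$-combs with $f(u,v)=\xi$; $\Gamma_f=\{\Gamma_f(i):i\in n\}$ and $\Gamma_f^\perp=\{a\subset m^{<\omega}: a\cap b\text{ finite for all } b\in\bigcup_{i\in n}\Gamma_f(i)\}$. -}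

module Defs where

open import Level using (0ℓ)
open import Data.Nat using (ℕ; suc; _<_)
open import Data.Fin using (Fin)
open import Data.List using (List; _∷ʳ_; _++_; length)
open import Data.List.Membership.Propositional using (_∈_)
open import Data.Product using (Σ; ∃; ∃-syntax; _×_; _,_)
open import Data.Sum using (_⊎_)
open import Relation.Nullary using (¬_)
open import Relation.Unary using (Pred; _⊆_; _∩_)
open import Relation.Binary.PropositionalEquality using (_≡_; _≢_)

data Colour (n : ℕ) : Set where
  fin : Fin n → Colour n
  ∞   : Colour n

Seq : ℕ → Set
Seq m = List (Fin m)

SetOf : ℕ → Set₁
SetOf m = Pred (Seq m) 0ℓ

_⊑_ : ∀ {m} → Seq m → Seq m → Set
s ⊑ t = ∃[ r ] (s ++ r ≡ t)

Finite : ∀ {m} → SetOf m → Set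
Finite {m} a = ∃[ L ] (∀ x → a x → x ∈ L)

Infinite : ∀ {m} → SetOf m → Set
Infinite a = ¬ Finite a

Image : ∀ {m} → (ℕ → Seq m) → SetOf m
Image s x = ∃[ i ] (s i ≡ x)

_≐_ : ∀ {m} → SetOf m → SetOf m → Set
a ≐ b = a ⊆ b × b ⊆ a

IsChain : ∀ {m} → Fin m → (ℕ → Seq m) → Set
IsChain u s = ∀ i → (s i ∷ʳ u) ⊑ s (suc i)

IsComb : ∀ {m} → Fin m → Fin m → SetOf m → Set
IsComb u v X =
    (u ≡ v × ∃[ s ] (IsChain u s × X ≐ Image s))
  ⊎ (u ≢ v × ∃[ s ] ∃[ t ] (IsChain u s
        × (∀ i → (s i ∷ʳ v) ⊑ t i)
        × (∀ i → length (t i) < length (s (suc i)))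
        × X ≐ Image t))

-- Γ_f(ξ): ideal generated by finite sets and (u,v)-combs with f(u,v)=ξ,
-- i.e. sets covered by a finite set together with finitely many such combs
Γ : ∀ {m n} → (Fin m → Fin m → Colour n) → Colour n → SetOf m → Set₁
Γ {m} f ξ a =
  ∃[ F ] ∃[ k ] Σ (Fin k → SetOf m) λ C →
      (∀ j → ∃[ u ] ∃[ v ] (f u v ≡ ξ × IsComb u v (C j)))
    × (∀ x → a x → x ∈ F ⊎ ∃[ j ] C j x)

Γ⊥ : ∀ {m n} → (Fin m → Fin m → Colour n) → SetOf m → Set₁
Γ⊥ {m} {n} f a = ∀ (i : Fin n) (b : SetOf m) → Γ f (fin i) b → Finite (a ∩ b)

Dense : ∀ {m n} → (Fin m → Fin m → Colour n) → Set₁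
Dense {m} f = ∀ (a : SetOf m) → Γ⊥ f a → Finite a

-- Two facts carry the proof.
-- (1) Geometry of combs.  Listing a (u,v)-comb by increasing length, any two
--     elements x, y are related by a "branch" relation: y extends x ⌢ u (if u = v),
--     or x and y leave a common node p in directions v and u (if u ≠ v).  Such a
--     pair x, y determines (u,v), so combs of different types meet in at most one
--     point.  As the colour is f u v, members of Γ_f(ξ) and Γ_f(ζ) meet finitely
--     for ξ ≠ ζ; taking ξ = ∞ gives Γ_f(∞) ⊆ Γ_f^⊥.
-- (2) A Ramsey-type theorem: every infinite A ⊆ m^{<ω} contains an infinite comb.
--     By König's lemma follow a branch along which A stays infinite; either A
--     meets the branch infinitely often (giving a chain), or elements of A leave it
--     arbitrarily late (giving a comb); the infinite pigeonhole principle fixes u, v.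
-- Density follows: an infinite comb inside an infinite x ∈ Γ_f^⊥ cannot have a
-- finite colour, so it lies in Γ_f(∞).  For the equivalence, every type (u,v)
-- carries an explicit infinite comb.

module Submission where

open import Defs
open import Data.Nat using (ℕ; zero; suc; _+_; _≤_; _<_; z≤n; s≤s; _∸_; _⊔_)
open import Data.Nat.Properties using (≤-trans; m≤m+n; m∸n+n≡m; +-comm; <-trans; <⇒≤; <-asym; <-irrefl; <-≤-trans; ≤-refl; n≤1+n; m≤m⊔n; m≤n⊔m; +-suc; <-cmp; n<1+n)
open import Data.Fin using (Fin; zero; suc; _≟_)
open import Data.List using (List; []; _∷_; _++_; _∷ʳ_; length; [_]; map)
open import Data.List.Properties using (++-assoc; ++-identityʳ; ++-cancelˡ; ∷-injective; ∷-injectiveˡ; length-++)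
open import Data.Product using (∃; ∃-syntax; _×_; _,_; proj₁; proj₂; Σ)
open import Data.Sum using (_⊎_; inj₁; inj₂)
open import Relation.Binary.PropositionalEquality using (_≡_; refl; sym; trans; cong; subst; _≢_; subst₂)
open import Data.List.Extrema.Nat using (max; xs≤max)
import Data.List.Relation.Unary.All as All
open import Data.List.Relation.Unary.Any using (here)
open import Data.List.Membership.Propositional using (_∈_)
open import Data.List.Membership.Propositional.Properties using (∈-++⁺ˡ; ∈-++⁺ʳ; ∈-map⁺)
open import Data.Empty using (⊥; ⊥-elim)
open import Relation.Nullary using (¬_; Dec; yes; no)
open import Relation.Nullary.Decidable using (map′; decidable-stable)
open import Relation.Unary using (_⊆_; _∩_; _∪_)
open import Relation.Binary using (tri<; tri≈; tri>)
open import Axiom.ExcludedMiddle using (ExcludedMiddle)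
open import Level using (0ℓ; lift; lower)
import Level
open import Function.Bundles using (_⇔_; mk⇔)

module _ {m : ℕ} where

  ⊑-refl : (s : Seq m) → s ⊑ s
  ⊑-refl s = [] , ++-identityʳ s

  ⊑-trans : {s t w : Seq m} → s ⊑ t → t ⊑ w → s ⊑ w
  ⊑-trans {s} (r , refl) (r' , refl) = r ++ r' , sym (++-assoc s r r')

  ⊑-snoc : (s : Seq m) (w : Fin m) → s ⊑ (s ∷ʳ w)
  ⊑-snoc s w = [ w ] , refl

  snoc-⊑ : {s t : Seq m} {w : Fin m} → (s ∷ʳ w) ⊑ t → s ⊑ t
  snoc-⊑ {s} {w = w} = ⊑-trans (⊑-snoc s w)

  length-∷ʳ : (s : Seq m) (w : Fin m) → length (s ∷ʳ w) ≡ suc (length s)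
  length-∷ʳ s w = trans (length-++ s) (+-comm (length s) 1)

  ⊑-length : {s t : Seq m} → s ⊑ t → length s ≤ length t
  ⊑-length {s} (r , refl) = subst (length s ≤_) (sym (length-++ s)) (m≤m+n (length s) (length r))

  snoc-⊑-length : {s t : Seq m} {w : Fin m} → (s ∷ʳ w) ⊑ t → length s < length t
  snoc-⊑-length {s} {t} {w} le = subst (_≤ length t) (length-∷ʳ s w) (⊑-length le)

  snoc-⊑-unique : {s t : Seq m} {a b : Fin m} → (s ∷ʳ a) ⊑ t → (s ∷ʳ b) ⊑ t → a ≡ b
  snoc-⊑-unique {s} {a = a} {b} (r , sar≡t) (r' , sbr'≡t) =
    ∷-injectiveˡ (++-cancelˡ s (a ∷ r) (b ∷ r')
      (trans (sym (++-assoc s [ a ] r)) (trans sar≡t (trans (sym sbr'≡t) (++-assoc s [ b ] r')))))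

  ⊑-comparable : {p q x : Seq m} → p ⊑ x → q ⊑ x → p ⊑ q ⊎ q ⊑ p
  ⊑-comparable {p} {q} (r , e) (r' , e') = go p q (trans e (sym e'))
    where
    go : (p q : Seq m) {r r' : Seq m} → p ++ r ≡ q ++ r' → p ⊑ q ⊎ q ⊑ p
    go []      q       _ = inj₁ (q , refl)
    go (a ∷ p) []      _ = inj₂ (a ∷ p , refl)
    go (a ∷ p) (b ∷ q) e with ∷-injective e
    ... | refl , e' with go p q e'
    ...   | inj₁ (z , pz≡q) = inj₁ (z , cong (a ∷_) pz≡q)
    ...   | inj₂ (z , qz≡p) = inj₂ (z , cong (a ∷_) qz≡p)

  ⊑-split : {p q : Seq m} → p ⊑ q → p ≡ q ⊎ ∃[ w ] ((p ∷ʳ w) ⊑ q)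
  ⊑-split {p} ([]    , e) = inj₁ (trans (sym (++-identityʳ p)) e)
  ⊑-split {p} (w ∷ r , e) = inj₂ (w , r , trans (++-assoc p [ w ] r) e)

  ⊑-monotone : (s : ℕ → Seq m) → (∀ i → s i ⊑ s (suc i)) → ∀ {i j} → i ≤ j → s i ⊑ s j
  ⊑-monotone s step {i} {j} i≤j = subst (λ k → s i ⊑ s k) (m∸n+n≡m i≤j) (go (j ∸ i))
    where
    go : ∀ d → s i ⊑ s (d + i)
    go zero    = ⊑-refl (s i)
    go (suc d) = ⊑-trans (go d) (step (d + i))

  chain-above : {u : Fin m} {s : ℕ → Seq m} → IsChain u s → ∀ {i j} → i < j → (s i ∷ʳ u) ⊑ s j
  chain-above {u} {s} ch i<j = ⊑-trans (ch _) (⊑-monotone s (λ i → snoc-⊑ (ch i)) i<j)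

module _ {m : ℕ} where

  -- How y lies beyond x inside a (u,v)-comb: for u = v, y extends x ⌢ u;
  -- for u ≠ v, x and y leave a common node p in the directions v and u.
  Branch : Fin m → Fin m → Seq m → Seq m → Set
  Branch u v x y = (u ≡ v × (x ∷ʳ u) ⊑ y)
                 ⊎ (u ≢ v × ∃[ p ] ((p ∷ʳ v) ⊑ x × (p ∷ʳ u) ⊑ y))

  Ordered : Fin m → Fin m → Seq m → Seq m → Set
  Ordered u v x y = length x < length y × Branch u v x y

  diverge : {u v w : Fin m} {p x y : Seq m} → u ≢ v →
            (p ∷ʳ v) ⊑ x → (p ∷ʳ u) ⊑ y → (p ∷ʳ w) ⊑ x → (p ∷ʳ w) ⊑ y → ⊥
  diverge u≢v pv⊑x pu⊑y pw⊑x pw⊑y =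
    u≢v (trans (snoc-⊑-unique pu⊑y pw⊑y) (sym (snoc-⊑-unique pv⊑x pw⊑x)))

  common-below-split : {u v : Fin m} {p q x y : Seq m} → u ≢ v →
                       (p ∷ʳ v) ⊑ x → (p ∷ʳ u) ⊑ y → q ⊑ x → q ⊑ y → q ⊑ p
  common-below-split {p = p} u≢v pv⊑x pu⊑y q⊑x q⊑y with ⊑-comparable (snoc-⊑ pv⊑x) q⊑x
  ... | inj₂ q⊑p = q⊑p
  ... | inj₁ p⊑q with ⊑-split p⊑q
  ...   | inj₁ refl = ⊑-refl p
  ...   | inj₂ (w , pw⊑q) = ⊥-elim (diverge u≢v pv⊑x pu⊑y (⊑-trans pw⊑q q⊑x) (⊑-trans pw⊑q q⊑y))

  branch-type : {u v u' v' : Fin m} {x y : Seq m} →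
                Branch u v x y → Branch u' v' x y → u ≡ u' × v ≡ v'
  branch-type (inj₁ (u≡v , xu⊑y)) (inj₁ (u'≡v' , xu'⊑y)) =
    let u≡u' = snoc-⊑-unique xu⊑y xu'⊑y in u≡u' , trans (sym u≡v) (trans u≡u' u'≡v')
  branch-type (inj₁ (_ , xu⊑y)) (inj₂ (u'≢v' , q , qv'⊑x , qu'⊑y)) =
    ⊥-elim (diverge u'≢v' qv'⊑x qu'⊑y qv'⊑x (⊑-trans qv'⊑x (snoc-⊑ xu⊑y)))
  branch-type (inj₂ (u≢v , p , pv⊑x , pu⊑y)) (inj₁ (_ , xu'⊑y)) =
    ⊥-elim (diverge u≢v pv⊑x pu⊑y pv⊑x (⊑-trans pv⊑x (snoc-⊑ xu'⊑y)))
  branch-type (inj₂ (u≢v , p , pv⊑x , pu⊑y)) (inj₂ (u'≢v' , q , qv'⊑x , qu'⊑y))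
    with ⊑-split (common-below-split u≢v pv⊑x pu⊑y (snoc-⊑ qv'⊑x) (snoc-⊑ qu'⊑y))
  ... | inj₁ refl = snoc-⊑-unique pu⊑y qu'⊑y , snoc-⊑-unique pv⊑x qv'⊑x
  ... | inj₂ (w , qw⊑p) =
    ⊥-elim (diverge u'≢v' qv'⊑x qu'⊑y (⊑-trans qw⊑p (snoc-⊑ pv⊑x)) (⊑-trans qw⊑p (snoc-⊑ pu⊑y)))

  Increasing : Fin m → Fin m → (ℕ → Seq m) → Set
  Increasing u v e = ∀ {i j} → i < j → Ordered u v (e i) (e j)

  comb-enumeration : {u v : Fin m} {X : SetOf m} → IsComb u v X →
                     ∃[ e ] (Increasing u v e × X ⊆ Image e)
  comb-enumeration (inj₁ (u≡v , s , chain , X⊆s , _)) =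
    s , (λ i<j → snoc-⊑-length (chain-above chain i<j) , inj₁ (u≡v , chain-above chain i<j)) , X⊆s
  comb-enumeration (inj₂ (u≢v , s , t , chain , sv⊑t , short , X⊆t , _)) =
    t , (λ i<j → length-increases i<j , inj₂ (u≢v , s _ , sv⊑t _ , ⊑-trans (chain-above chain i<j) (snoc-⊑ (sv⊑t _)))) , X⊆t
    where
    length-increases : ∀ {i j} → i < j → length (t i) < length (t j)
    length-increases {i} {j} i<j =
      <-≤-trans (short i)
        (≤-trans (⊑-length (⊑-monotone s (λ k → snoc-⊑ (chain k)) i<j)) (<⇒≤ (snoc-⊑-length (sv⊑t j))))

  comb-trichotomy : {u v : Fin m} {X : SetOf m} → IsComb u v X → {x y : Seq m} → X x → X y →
                    x ≡ y ⊎ Ordered u v x y ⊎ Ordered u v y x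
  comb-trichotomy comb Xx Xy with comb-enumeration comb
  ... | e , increasing , X⊆e with X⊆e Xx | X⊆e Xy
  ...   | i , refl | j , refl with <-cmp i j
  ...     | tri< i<j _ _ = inj₂ (inj₁ (increasing i<j))
  ...     | tri≈ _ refl _ = inj₁ refl
  ...     | tri> _ _ j<i = inj₂ (inj₂ (increasing j<i))

  combs-meet-once : {u v u' v' : Fin m} {X Y : SetOf m} → IsComb u v X → IsComb u' v' Y →
                    {x y : Seq m} → (X ∩ Y) x → (X ∩ Y) y → x ≡ y ⊎ (u ≡ u' × v ≡ v')
  combs-meet-once cX cY (Xx , Yx) (Xy , Yy) with comb-trichotomy cX Xx Xy | comb-trichotomy cY Yx Yy
  ... | inj₁ x≡y | _ = inj₁ x≡y
  ... | inj₂ _ | inj₁ x≡y = inj₁ x≡y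
  ... | inj₂ (inj₁ (_ , b)) | inj₂ (inj₁ (_ , b')) = inj₂ (branch-type b b')
  ... | inj₂ (inj₂ (_ , b)) | inj₂ (inj₂ (_ , b')) = inj₂ (branch-type b b')
  ... | inj₂ (inj₁ (x<y , _)) | inj₂ (inj₂ (y<x , _)) = ⊥-elim (<-asym x<y y<x)
  ... | inj₂ (inj₂ (y<x , _)) | inj₂ (inj₁ (x<y , _)) = ⊥-elim (<-asym x<y y<x)

module _ {m : ℕ} where

  finite-⊆ : {a b : SetOf m} → a ⊆ b → Finite b → Finite a
  finite-⊆ a⊆b (L , b⊆L) = L , λ x ax → b⊆L x (a⊆b ax)

  finite-list : (L : List (Seq m)) → Finite (_∈ L)
  finite-list L = L , λ _ x∈L → x∈L

  finite-∪ : {a b : SetOf m} → Finite a → Finite b → Finite (a ∪ b)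
  finite-∪ (L , a⊆L) (L' , b⊆L') = L ++ L' , λ
    { x (inj₁ ax) → ∈-++⁺ˡ (a⊆L x ax)
    ; x (inj₂ bx) → ∈-++⁺ʳ L (b⊆L' x bx) }

  finite-⋃ : (k : ℕ) (C : Fin k → SetOf m) → (∀ j → Finite (C j)) → Finite (λ x → ∃[ j ] C j x)
  finite-⋃ zero    C finite = [] , λ { _ (() , _) }
  finite-⋃ (suc k) C finite =
    finite-⊆ split (finite-∪ (finite zero) (finite-⋃ k (λ j → C (suc j)) (λ j → finite (suc j))))
    where
    split : (λ x → ∃[ j ] C j x) ⊆ (C zero ∪ (λ x → ∃[ j ] C (suc j) x))
    split (zero  , Cx) = inj₁ Cx
    split (suc j , Cx) = inj₂ (j , Cx)

  long-image-infinite : (t : ℕ → Seq m) → (∀ i → i ≤ length (t i)) → Infinite (Image t)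
  long-image-infinite t long (L , t⊆L) = <-irrefl refl (≤-trans (long (suc M)) bound)
    where
    M : ℕ
    M = max 0 (map length L)
    bound : length (t (suc M)) ≤ M
    bound = All.lookup (xs≤max 0 (map length L)) (∈-map⁺ length (t⊆L _ (suc M , refl)))

Unbounded : (ℕ → Set) → Set
Unbounded P = ∀ N → ∃[ k ] (N ≤ k × P k)

unbounded-map : {P Q : ℕ → Set} → (∀ {k} → P k → Q k) → Unbounded P → Unbounded Q
unbounded-map P⇒Q unbounded N with unbounded N
... | k , N≤k , Pk = k , N≤k , P⇒Q Pk

-- An unbounded set, listed increasingly with prescribed gaps: after the index k
-- (with witness p) the next index is at least gap k p.
module Subsequence (P : ℕ → Set) (gap : ∀ k → P k → ℕ) (unbounded : Unbounded P) where

  pick : ℕ → Σ ℕ P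
  pick zero    = let (k , _ , Pk) = unbounded 0 in k , Pk
  pick (suc i) = let (k , _ , Pk) = unbounded (gap (proj₁ (pick i)) (proj₂ (pick i))) in k , Pk

  index : ℕ → ℕ
  index i = proj₁ (pick i)

  index-holds : ∀ i → P (index i)
  index-holds i = proj₂ (pick i)

  gap-respected : ∀ i → gap (index i) (index-holds i) ≤ index (suc i)
  gap-respected i = proj₁ (proj₂ (unbounded (gap (index i) (index-holds i))))

  index-≥ : (∀ i → index i < index (suc i)) → ∀ i → i ≤ index i
  index-≥ increasing zero    = z≤n
  index-≥ increasing (suc i) = ≤-trans (s≤s (index-≥ increasing i)) (increasing i)

module Classical (lem : ExcludedMiddle (Level.suc 0ℓ)) where

  em : (P : Set) → Dec P
  em P = map′ lower lift lem

  dne : {P : Set} → ¬ ¬ P → P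
  dne {P} = decidable-stable (em P)

  nonempty : {m : ℕ} {a : SetOf m} → Infinite a → ∃[ x ] a x
  nonempty infinite = dne λ empty → infinite ([] , λ x ax → ⊥-elim (empty (x , ax)))

  subsingleton-finite : {m : ℕ} {a : SetOf m} → (∀ {x y} → a x → a y → x ≡ y) → Finite a
  subsingleton-finite {a = a} unique with em (∃[ x ] a x)
  ... | yes (x , ax) = [ x ] , λ y ay → here (unique ay ax)
  ... | no  empty    = [] , λ y ay → ⊥-elim (empty (y , ay))

  eventually-false : {P : ℕ → Set} → ¬ Unbounded P → ∃[ N ] (∀ k → N ≤ k → ¬ P k)
  eventually-false not-unbounded =
    dne λ never → not-unbounded λ N → dne λ none → never (N , λ k N≤k Pk → none (k , N≤k , Pk))

  unbounded-⊎ : {P Q : ℕ → Set} → Unbounded (λ k → P k ⊎ Q k) → Unbounded P ⊎ Unbounded Q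
  unbounded-⊎ {P} {Q} unbounded with em (Unbounded P)
  ... | yes P-unbounded = inj₁ P-unbounded
  ... | no  P-bounded   = inj₂ Q-unbounded
    where
    Q-unbounded : Unbounded Q
    Q-unbounded N with eventually-false P-bounded
    ... | N₀ , no-P with unbounded (N ⊔ N₀)
    ...   | k , le , inj₁ Pk = ⊥-elim (no-P k (≤-trans (m≤n⊔m N N₀) le) Pk)
    ...   | k , le , inj₂ Qk = k , ≤-trans (m≤m⊔n N N₀) le , Qk

  pigeonhole : (m : ℕ) (Q : ℕ → Fin m → Set) → Unbounded (λ k → ∃ (Q k)) → ∃[ w ] Unbounded (λ k → Q k w)
  pigeonhole zero    Q unbounded with unbounded 0
  ... | _ , _ , () , _
  pigeonhole (suc m) Q unbounded with unbounded-⊎ (unbounded-map split unbounded)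
    where
    split : ∀ {k} → ∃ (Q k) → Q k zero ⊎ ∃[ w ] Q k (suc w)
    split (zero  , q) = inj₁ q
    split (suc w , q) = inj₂ (w , q)
  ... | inj₁ zero-unbounded = zero , zero-unbounded
  ... | inj₂ rest-unbounded with pigeonhole m (λ k w → Q k (suc w)) rest-unbounded
  ...   | w , w-unbounded = suc w , w-unbounded

  last-holding : (P : ℕ → Set) → ∀ d k → P k → ¬ P (d + k) → ∃[ j ] (k ≤ j × P j × ¬ P (suc j))
  last-holding P zero    k Pk ¬Pd+k = ⊥-elim (¬Pd+k Pk)
  last-holding P (suc d) k Pk ¬Pd+k with em (P (suc k))
  ... | no  ¬Pk+1 = k , ≤-refl , Pk , ¬Pk+1
  ... | yes Pk+1 with last-holding P d (suc k) Pk+1 (subst (λ z → ¬ P z) (sym (+-suc d k)) ¬Pd+k)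
  ...   | j , k<j , Pj , ¬Pj+1 = j , ≤-trans (n≤1+n k) k<j , Pj , ¬Pj+1

module KönigBranch {m : ℕ} (Good : Seq m → Set) (root : Good [])
                   (grow : ∀ {s} → Good s → ∃[ w ] Good (s ∷ʳ w)) where

  node : ℕ → Σ (Seq m) Good
  node zero    = [] , root
  node (suc k) = (proj₁ (node k) ∷ʳ proj₁ (grow (proj₂ (node k)))) , proj₂ (grow (proj₂ (node k)))

  branch : ℕ → Seq m
  branch k = proj₁ (node k)

  direction : ℕ → Fin m
  direction k = proj₁ (grow (proj₂ (node k)))

  branch-good : ∀ k → Good (branch k)
  branch-good k = proj₂ (node k)

  length-branch : ∀ k → length (branch k) ≡ k
  length-branch zero    = refl
  length-branch (suc k) = trans (length-∷ʳ (branch k) (direction k)) (cong suc (length-branch k))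

  branch-monotone : ∀ {i j} → i ≤ j → branch i ⊑ branch j
  branch-monotone = ⊑-monotone branch (λ k → ⊑-snoc (branch k) (direction k))

InfiniteCombIn : {m : ℕ} → SetOf m → Set₁
InfiniteCombIn {m} A = ∃[ u ] ∃[ v ] ∃[ X ] (X ⊆ A × IsComb u v X × Infinite X)

-- Follow a branch along which A stays infinite; either infinitely many branch nodes
-- lie in A (giving a chain), or infinitely often an element of A leaves the branch
-- (giving a comb); pigeonholing fixes the directions.
module Ramsey (lem : ExcludedMiddle (Level.suc 0ℓ)) {m : ℕ} (A : SetOf m) (A-infinite : Infinite A) where
  open Classical lem

  Above : Seq m → SetOf m
  Above s y = A y × s ⊑ y

  infinite-child : ∀ {s} → Infinite (Above s) → ∃[ w ] Infinite (Above (s ∷ʳ w))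
  infinite-child {s} s-infinite = dne λ no-child →
    s-infinite (finite-⊆ split (finite-∪ (finite-list [ s ])
      (finite-⋃ m (λ w → Above (s ∷ʳ w)) (λ w → dne λ w-infinite → no-child (w , w-infinite)))))
    where
    split : Above s ⊆ ((_∈ [ s ]) ∪ (λ y → ∃[ w ] Above (s ∷ʳ w) y))
    split (Ay , []    , s[]≡y) = inj₁ (here (trans (sym s[]≡y) (++-identityʳ s)))
    split (Ay , w ∷ r , swr≡y) = inj₂ (w , Ay , r , trans (++-assoc s [ w ] r) swr≡y)

  open KönigBranch (λ s → Infinite (Above s))
                   (λ finite → A-infinite (finite-⊆ (λ Ay → Ay , _ , refl) finite))
                   infinite-child

  chain-case : (u : Fin m) → Unbounded (λ k → A (branch k) × direction k ≡ u) → InfiniteCombIn A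
  chain-case u unbounded =
    u , u , Image s , s⊆A , inj₁ (refl , s , chain , (λ p → p) , (λ p → p)) ,
    long-image-infinite s (λ i → subst (i ≤_) (sym (length-branch _)) (index-≥ gap-respected i))
    where
    open Subsequence (λ k → A (branch k) × direction k ≡ u) (λ k _ → suc k) unbounded
    s : ℕ → Seq m
    s i = branch (index i)
    chain : IsChain u s
    chain i = subst (λ w → (s i ∷ʳ w) ⊑ s (suc i)) (proj₂ (index-holds i)) (branch-monotone (gap-respected i))
    s⊆A : Image s ⊆ A
    s⊆A (i , refl) = proj₁ (index-holds i)

  record Leaves (v : Fin m) (j : ℕ) : Set where
    field
      off-branch   : v ≢ direction j
      leaver       : Seq m
      leaver∈A     : A leaver
      leaver-above : (branch j ∷ʳ v) ⊑ leaver

  -- If the branch eventually avoids A, elements of A leave it arbitrarily late: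
  -- an element y of A above branch k follows the branch up to a last node j ≥ k.
  leaving-unbounded : (N : ℕ) → (∀ k → N ≤ k → ¬ A (branch k)) → Unbounded (λ j → ∃[ v ] Leaves v j)
  leaving-unbounded N avoids K with nonempty (branch-good (K ⊔ N))
  ... | y , Ay , below with last-holding (λ j → branch j ⊑ y) (suc (length y)) (K ⊔ N) below too-long
    where
    too-long : ¬ (branch (suc (length y) + (K ⊔ N)) ⊑ y)
    too-long b⊑y = <-irrefl refl (≤-trans (m≤m+n (suc (length y)) (K ⊔ N))
                                   (subst (_≤ length y) (length-branch _) (⊑-length b⊑y)))
  ... | j , K⊔N≤j , ([] , bj[]≡y) , not-next =
        ⊥-elim (avoids j (≤-trans (m≤n⊔m K N) K⊔N≤j) (subst A (trans (sym bj[]≡y) (++-identityʳ (branch j))) Ay))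
  ... | j , K⊔N≤j , (v ∷ r , bjvr≡y) , not-next =
        j , ≤-trans (m≤m⊔n K N) K⊔N≤j , v , record
          { off-branch   = λ v≡dir → not-next (subst (λ w → (branch j ∷ʳ w) ⊑ y) v≡dir bjv⊑y)
          ; leaver       = y
          ; leaver∈A     = Ay
          ; leaver-above = bjv⊑y }
    where
    bjv⊑y : (branch j ∷ʳ v) ⊑ y
    bjv⊑y = r , trans (++-assoc (branch j) [ v ] r) bjvr≡y

  -- Infinitely often, leaving in direction v from a branch node continuing in direction u:
  -- those elements of A form a (u,v)-comb along the u-chain of their leaving nodes.
  comb-case : (u v : Fin m) → Unbounded (λ j → direction j ≡ u × Leaves v j) → InfiniteCombIn A
  comb-case u v unbounded =
    u , v , Image t , t⊆A , inj₂ (u≢v , s , t , chain , sv⊑t , short , (λ p → p) , (λ p → p)) ,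
    long-image-infinite t (λ i → ≤-trans (index-≥ increasing i) (<⇒≤ (index<length i)))
    where
    open Leaves
    open Subsequence (λ j → direction j ≡ u × Leaves v j) (λ _ p → suc (length (leaver (proj₂ p)))) unbounded
    s t : ℕ → Seq m
    s i = branch (index i)
    t i = leaver (proj₂ (index-holds i))
    sv⊑t : ∀ i → (s i ∷ʳ v) ⊑ t i
    sv⊑t i = leaver-above (proj₂ (index-holds i))
    index<length : ∀ i → index i < length (t i)
    index<length i = subst (_< length (t i)) (length-branch _) (snoc-⊑-length (sv⊑t i))
    short : ∀ i → length (t i) < length (s (suc i))
    short i = subst (length (t i) <_) (sym (length-branch _)) (gap-respected i)
    increasing : ∀ i → index i < index (suc i)
    increasing i = <-trans (index<length i) (gap-respected i)
    chain : IsChain u s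
    chain i = subst (λ w → (s i ∷ʳ w) ⊑ s (suc i)) (proj₁ (index-holds i)) (branch-monotone (increasing i))
    u≢v : u ≢ v
    u≢v u≡v = off-branch (proj₂ (index-holds 0)) (trans (sym u≡v) (sym (proj₁ (index-holds 0))))
    t⊆A : Image t ⊆ A
    t⊆A (i , refl) = leaver∈A (proj₂ (index-holds i))

  infinite-comb : InfiniteCombIn A
  infinite-comb with em (Unbounded (λ k → A (branch k)))
  ... | yes on-branch with pigeonhole m (λ k u → A (branch k) × direction k ≡ u)
                                        (unbounded-map (λ Ab → _ , Ab , refl) on-branch)
  ...   | u , u-unbounded = chain-case u u-unbounded
  infinite-comb | no off-branch with eventually-false off-branch
  ... | N , avoids with pigeonhole m (λ j v → Leaves v j) (leaving-unbounded N avoids)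
  ...   | v , v-unbounded with pigeonhole m (λ j u → direction j ≡ u × Leaves v j)
                                           (unbounded-map (λ l → _ , refl , l) v-unbounded)
  ...     | u , uv-unbounded = comb-case u v uv-unbounded

module _ {m n : ℕ} {f : Fin m → Fin m → Colour n} where

  comb-in-Γ : {u v : Fin m} {ξ : Colour n} {X : SetOf m} → IsComb u v X → f u v ≡ ξ → Γ f ξ X
  comb-in-Γ {u} {v} {X = X} comb colour = [] , 1 , (λ _ → X) , (λ _ → u , v , colour , comb) , λ _ Xx → inj₂ (zero , Xx)

  Γ-unused-colour-finite : {ξ : Colour n} {a : SetOf m} → ¬ (∃[ u ] ∃[ v ] (f u v ≡ ξ)) → Γ f ξ a → Finite a
  Γ-unused-colour-finite {a = a} unused (F , k , C , combs , cover) = F , only-F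
    where
    only-F : ∀ x → a x → x ∈ F
    only-F x ax with cover x ax
    ... | inj₁ x∈F = x∈F
    ... | inj₂ (j , _) = let (u , v , colour , _) = combs j in ⊥-elim (unused (u , v , colour))

  module _ (lem : ExcludedMiddle (Level.suc 0ℓ)) where
    open Classical lem

    -- Combs of distinct colours have distinct types, so they meet in at most one point.
    combs-of-distinct-colours : {u v u' v' : Fin m} {ξ ζ : Colour n} {X Y : SetOf m} → ξ ≢ ζ →
                                f u v ≡ ξ → f u' v' ≡ ζ → IsComb u v X → IsComb u' v' Y → Finite (X ∩ Y)
    combs-of-distinct-colours {X = X} {Y} ξ≢ζ colour colour' cX cY = subsingleton-finite at-most-one
      where
      at-most-one : ∀ {x y} → (X ∩ Y) x → (X ∩ Y) y → x ≡ y
      at-most-one x∈ y∈ with combs-meet-once cX cY x∈ y∈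
      ... | inj₁ x≡y = x≡y
      ... | inj₂ (refl , refl) = ⊥-elim (ξ≢ζ (trans (sym colour) colour'))

    Γ-orthogonal : {ξ ζ : Colour n} {a b : SetOf m} → ξ ≢ ζ → Γ f ξ a → Γ f ζ b → Finite (a ∩ b)
    Γ-orthogonal {a = a} {b} ξ≢ζ (F , k , C , combs , a-cover) (F' , k' , C' , combs' , b-cover) =
      finite-⊆ cover (finite-∪ (finite-list F) (finite-∪ (finite-list F')
        (finite-⋃ k _ λ j → finite-⋃ k' _ λ j' → pieces-finite j j')))
      where
      pieces-finite : ∀ j j' → Finite (C j ∩ C' j')
      pieces-finite j j' =
        let (_ , _ , colour , cX) = combs j ; (_ , _ , colour' , cY) = combs' j'
        in combs-of-distinct-colours ξ≢ζ colour colour' cX cY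
      cover : a ∩ b ⊆ ((_∈ F) ∪ ((_∈ F') ∪ (λ x → ∃[ j ] ∃[ j' ] (C j ∩ C' j') x)))
      cover {x} (ax , bx) with a-cover x ax | b-cover x bx
      ... | inj₁ x∈F | _ = inj₁ x∈F
      ... | inj₂ _ | inj₁ x∈F' = inj₂ (inj₁ x∈F')
      ... | inj₂ (j , Cx) | inj₂ (j' , C'x) = inj₂ (inj₂ (j , j' , Cx , C'x))

    Γ∞⊆Γ⊥ : ∀ a → Γ f ∞ a → Γ⊥ f a
    Γ∞⊆Γ⊥ a a∈Γ∞ i b b∈Γi = Γ-orthogonal (λ ()) a∈Γ∞ b∈Γi

    -- Density: an infinite member of Γ_f^⊥ contains an infinite comb, which can
    -- only have colour ∞ since combs of a finite colour meet it finitely.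
    Γ∞-dense : ∀ x → Γ⊥ f x → Infinite x → ∃[ x' ] (x' ⊆ x × Γ f ∞ x' × Infinite x')
    Γ∞-dense x x-perp x-infinite with Ramsey.infinite-comb lem x x-infinite
    ... | u , v , X , X⊆x , comb , X-infinite with f u v in colour
    ...   | fin i = ⊥-elim (X-infinite (finite-⊆ (λ Xy → X⊆x Xy , Xy) (x-perp i X (comb-in-Γ comb colour))))
    ...   | ∞     = X , X⊆x , comb-in-Γ comb colour , X-infinite

module _ {m : ℕ} (u : Fin m) where

  -- The u-chain ∅, u², u⁴, …: consecutive elements differ by two letters,
  -- leaving room for the teeth of a comb.
  even-chain : ℕ → Seq m
  even-chain zero    = []
  even-chain (suc i) = (even-chain i ∷ʳ u) ∷ʳ u

  even-chain-is-chain : IsChain u even-chain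
  even-chain-is-chain i = [ u ] , refl

  length-even-chain-suc : ∀ i → length (even-chain (suc i)) ≡ suc (suc (length (even-chain i)))
  length-even-chain-suc i = trans (length-∷ʳ (even-chain i ∷ʳ u) u) (cong suc (length-∷ʳ (even-chain i) u))

  even-chain-long : ∀ i → i ≤ length (even-chain i)
  even-chain-long zero    = z≤n
  even-chain-long (suc i) =
    subst (suc i ≤_) (sym (length-even-chain-suc i)) (s≤s (≤-trans (even-chain-long i) (n≤1+n _)))

  infinite-comb-of-type : (v : Fin m) → ∃[ X ] (IsComb u v X × Infinite X)
  infinite-comb-of-type v with u ≟ v
  ... | yes refl =
    Image even-chain , inj₁ (refl , even-chain , even-chain-is-chain , (λ p → p) , (λ p → p)) ,
    long-image-infinite even-chain even-chain-long
  ... | no u≢v =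
    Image tooth , inj₂ (u≢v , even-chain , tooth , even-chain-is-chain , (λ i → ⊑-refl (tooth i)) , short , (λ p → p) , (λ p → p)) ,
    long-image-infinite tooth (λ i → ≤-trans (even-chain-long i) (⊑-length (⊑-snoc (even-chain i) v)))
    where
    tooth : ℕ → Seq m
    tooth i = even-chain i ∷ʳ v
    short : ∀ i → length (tooth i) < length (even-chain (suc i))
    short i = subst₂ _<_ (sym (length-∷ʳ (even-chain i) v)) (sym (length-even-chain-suc i)) (n<1+n _)

mainTheorem5 : ExcludedMiddle (Level.suc 0ℓ) → (m n : ℕ) → (f : Fin m → Fin m → Colour n) →
    (∀ a → Γ f ∞ a → Γ⊥ f a)
    × (∀ x → Γ⊥ f x → Infinite x → ∃[ x' ] (x' ⊆ x × Γ f ∞ x' × Infinite x'))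
    × (Dense f ⇔ (¬ (∃[ u ] ∃[ v ] (f u v ≡ ∞))))
mainTheorem5 lem m n f = Γ∞⊆Γ⊥ lem , Γ∞-dense lem , mk⇔ dense⇒no-∞ no-∞⇒dense
  where
  open Classical lem

  dense⇒no-∞ : Dense f → ¬ (∃[ u ] ∃[ v ] (f u v ≡ ∞))
  dense⇒no-∞ dense (u , v , colour) =
    let (X , comb , X-infinite) = infinite-comb-of-type u v
    in X-infinite (dense X (Γ∞⊆Γ⊥ lem X (comb-in-Γ comb colour)))

  no-∞⇒dense : ¬ (∃[ u ] ∃[ v ] (f u v ≡ ∞)) → Dense f
  no-∞⇒dense no-∞ a a-perp = dne λ a-infinite →
    let (_ , _ , x'∈Γ∞ , x'-infinite) = Γ∞-dense lem a a-perp a-infinite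
    in x'-infinite (Γ-unused-colour-finite no-∞ x'∈Γ∞)
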